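{- Every order embedding in $\mathsf{PoSet}$ is a regular monomorphism.
   Context: $\mathsf{PoSet}$ is the category of finite sets with a strict partial order (asymmetric, transitive relation) and strictly order-preserving maps. A regular monomorphism is a morphism that is the equalizer of some parallel pair of morphisms. A morphism $f:(A,P_A)\to(B,P_B)$ is an order embedding if its corestriction $\hat f:(A,P_A)\to(f(A),P_B\cap(f(A)\times f(A)))$, $\hat f(a)=f(a)$, is an isomorphism in $\mathsf{PoSet}$. -}

module Defs where

open import Data.Nat using (ℕ)
open import Data.Fin using (Fin; _≟_)
open import Data.Fin.Properties using (any?)
open import Data.Product using (Σ; Σ-syntax; ∃; ∃-syntax; _×_; _,_; proj₁; proj₂)
open import Relation.Nullary using (¬_)
open import Relation.Nullary.Decidable using (True; fromWitness)
open import Relation.Binary.PropositionalEquality using (_≡_; refl)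

-- A finite strict poset: carrier Fin n (every finite set is in bijection
-- with some Fin n), with an asymmetric transitive relation.
record PoSet : Set₁ where
  field
    size  : ℕ
    _<_   : Fin size → Fin size → Set
    asym  : ∀ {x y} → x < y → ¬ (y < x)
    trans : ∀ {x y z} → x < y → y < z → x < z

open PoSet public

El : PoSet → Set
El A = Fin (size A)

record Hom (A B : PoSet) : Set where
  field
    fun  : El A → El B
    mono : ∀ {x y} → _<_ A x y → _<_ B (fun x) (fun y)

open Hom public

_≈_ : ∀ {A B} → Hom A B → Hom A B → Set
f ≈ g = ∀ x → fun f x ≡ fun g x

_∘_ : ∀ {A B C} → Hom B C → Hom A B → Hom A C
fun (g ∘ f) x = fun g (fun f x)
mono (g ∘ f) p = mono g (mono f p)

IsEqualizer : ∀ {E A B} → Hom E A → Hom A B → Hom A B → Set₁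
IsEqualizer {E} {A} {B} e f g =
  ((f ∘ e) ≈ (g ∘ e)) ×
  (∀ (X : PoSet) (h : Hom X A) → (f ∘ h) ≈ (g ∘ h) →
     Σ[ u ∈ Hom X E ] ((e ∘ u) ≈ h × (∀ (u' : Hom X E) → (e ∘ u') ≈ h → u' ≈ u)))

IsRegularMono : ∀ {A B} → Hom A B → Set₁
IsRegularMono {A} {B} m =
  Σ[ C ∈ PoSet ] Σ[ f ∈ Hom B C ] Σ[ g ∈ Hom B C ] IsEqualizer m f g

-- The image f(A) ⊆ B as a subset (decidable membership, proof-irrelevant).
InImage : ∀ {A B} → Hom A B → El B → Set
InImage {A} f b = True (any? (λ a → fun f a ≟ b))

Image : ∀ {A B} → Hom A B → Set
Image {A} {B} f = Σ[ b ∈ El B ] InImage f b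

_<Im_ : ∀ {A B} {f : Hom A B} → Image f → Image f → Set
_<Im_ {A} {B} x y = _<_ B (proj₁ x) (proj₁ y)

corestr : ∀ {A B} (f : Hom A B) → El A → Image f
corestr f a = fun f a , fromWitness (a , refl)

-- f̂ is an isomorphism in PoSet: it is strictly monotone (automatically,
-- since f is), and it has a two-sided inverse that is strictly monotone
-- with respect to the induced order.
CorestrIsIso : ∀ {A B} → Hom A B → Set
CorestrIsIso {A} {B} f =
  Σ[ g ∈ (Image f → El A) ]
    ((∀ {x y} → _<Im_ {f = f} x y → _<_ A (g x) (g y)) ×
     (∀ a → g (corestr f a) ≡ a) ×
     (∀ y → corestr f (g y) ≡ y))

IsOrderEmbedding : ∀ {A B} → Hom A B → Set
IsOrderEmbedding = CorestrIsIso

{-# OPTIONS --safe #-}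
module Submission where

-- Let C be B ⊔ B, ordered by comparing underlying points of B. The left
-- inclusion and the map sending f(A) to the left copy and the rest of B to the
-- right copy are then both morphisms, and they agree exactly on f(A). A map
-- landing in f(A) lifts through the inverse of the corestriction, uniquely
-- because f is injective.

open import Defs
open import Function using (id; _∘′_)
open import Data.Bool.Properties using (T-irrelevant)
open import Data.Nat using (_+_)
open import Data.Fin using (Fin; _≟_; splitAt; join)
open import Data.Fin.Properties using (any?; splitAt-join)
open import Data.Sum using (_⊎_; inj₁; inj₂; [_,_]′)
open import Data.Product using (Σ-syntax; _×_; _,_; proj₁; proj₂)
open import Relation.Nullary using (yes; no)
open import Relation.Nullary.Decidable using (True)
open import Relation.Unary using (Pred; Decidable)
open import Relation.Binary.PropositionalEquality
  using (_≡_; refl; sym; cong; subst₂; module ≡-Reasoning)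
  renaming (trans to ≡-trans)

induced : ∀ (B : PoSet) {m} → (Fin m → El B) → PoSet
induced B {m} k = record
  { size  = m
  ; _<_   = λ x y → _<_ B (k x) (k y)
  ; asym  = asym B
  ; trans = trans B
  }

section-hom : ∀ (B : PoSet) {m} (k : Fin m → El B) (s : El B → Fin m) →
              (∀ b → k (s b) ≡ b) → Hom B (induced B k)
fun  (section-hom B k s ks)         = s
mono (section-hom B k s ks) {x} {y} = subst₂ (_<_ B) (sym (ks x)) (sym (ks y))

join-injective : ∀ m n {s t : Fin m ⊎ Fin n} → join m n s ≡ join m n t → s ≡ t
join-injective m n {s} {t} eq = begin
  s                      ≡⟨ splitAt-join m n s ⟨
  splitAt m (join m n s) ≡⟨ cong (splitAt m) eq ⟩
  splitAt m (join m n t) ≡⟨ splitAt-join m n t ⟩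
  t                      ∎
  where open ≡-Reasoning

codiagonal : ∀ n → Fin (n + n) → Fin n
codiagonal n = [ id , id ]′ ∘′ splitAt n

double : PoSet → PoSet
double B = induced B (codiagonal (size B))

tagged-hom : ∀ (B : PoSet) (σ : El B → El B ⊎ El B) →
             (∀ b → [ id , id ]′ (σ b) ≡ b) → Hom B (double B)
tagged-hom B σ σ-untag = section-hom B (codiagonal n) (join n n ∘′ σ) untag
  where
  n = size B
  untag : ∀ b → codiagonal n (join n n (σ b)) ≡ b
  untag b = ≡-trans (cong [ id , id ]′ (splitAt-join n n (σ b))) (σ-untag b)

mark : ∀ {n ℓ} {P : Pred (Fin n) ℓ} → Decidable P → Fin n → Fin n ⊎ Fin n
mark P? b with P? b
... | yes _ = inj₁ b
... | no  _ = inj₂ b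

mark-untag : ∀ {n ℓ} {P : Pred (Fin n) ℓ} (P? : Decidable P) b →
             [ id , id ]′ (mark P? b) ≡ b
mark-untag P? b with P? b
... | yes _ = refl
... | no  _ = refl

mark-yes : ∀ {n ℓ} {P : Pred (Fin n) ℓ} (P? : Decidable P) {b} →
           True (P? b) → mark P? b ≡ inj₁ b
mark-yes P? {b} _ with P? b
... | yes _ = refl

inj₁≡mark⇒True : ∀ {n ℓ} {P : Pred (Fin n) ℓ} (P? : Decidable P) {b} →
                 inj₁ b ≡ mark P? b → True (P? b)
inj₁≡mark⇒True P? {b} eq with P? b
... | yes _ = _
inj₁≡mark⇒True P? {b} () | no _

inImage? : ∀ {A B} (f : Hom A B) → Decidable (λ b → Σ[ a ∈ El A ] fun f a ≡ b)
inImage? f b = any? (λ a → fun f a ≟ b)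

Image-≡ : ∀ {A B} (f : Hom A B) {x y : Image f} → proj₁ x ≡ proj₁ y → x ≡ y
Image-≡ f {b , s} {.b , s'} refl = cong (b ,_) (T-irrelevant s s')

embedding-injective : ∀ {A B} {f : Hom A B} → IsOrderEmbedding f →
                      ∀ {a a'} → fun f a ≡ fun f a' → a ≡ a'
embedding-injective {f = f} (g , _ , g∘corestr , _) {a} {a'} eq = begin
  a                ≡⟨ g∘corestr a ⟨
  g (corestr f a)  ≡⟨ cong g (Image-≡ f eq) ⟩
  g (corestr f a') ≡⟨ g∘corestr a' ⟩
  a'               ∎
  where open ≡-Reasoning

embedding-lift : ∀ {A B X} {f : Hom A B} → IsOrderEmbedding f →
                 (h : Hom X B) → (∀ x → InImage f (fun h x)) →
                 Σ[ u ∈ Hom X A ] ((f ∘ u) ≈ h × (∀ u' → (f ∘ u') ≈ h → u' ≈ u))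
embedding-lift {A} {X = X} {f} emb@(g , g-mono , _ , corestr∘g) h h∈f =
  u , f∘u≈h , λ u' f∘u'≈h x →
    embedding-injective {f = f} emb (≡-trans (f∘u'≈h x) (sym (f∘u≈h x)))
  where
  u : Hom X A
  fun  u x  = g (fun h x , h∈f x)
  mono u lt = g-mono (mono h lt)

  f∘u≈h : (f ∘ u) ≈ h
  f∘u≈h x = cong proj₁ (corestr∘g (fun h x , h∈f x))

lemmaA14 : ∀ {A B : PoSet} (f : Hom A B) → IsOrderEmbedding f → IsRegularMono f
lemmaA14 {A} {B} f emb = double B , left , split , agree-on-f , universal
  where
  n = size B
  left split : Hom B (double B)
  left  = tagged-hom B inj₁ (λ _ → refl)
  split = tagged-hom B (mark (inImage? f)) (mark-untag (inImage? f))

  agree-on-f : (left ∘ f) ≈ (split ∘ f)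
  agree-on-f a = cong (join n n) (sym (mark-yes (inImage? f) (proj₂ (corestr f a))))

  universal : ∀ X (h : Hom X B) → (left ∘ h) ≈ (split ∘ h) →
              Σ[ u ∈ Hom X A ] ((f ∘ u) ≈ h × (∀ u' → (f ∘ u') ≈ h → u' ≈ u))
  universal _ h agree = embedding-lift {f = f} emb h λ x →
    inj₁≡mark⇒True (inImage? f) (join-injective n n (agree x))
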